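{- Suppose $n\ge 4$ is even, $\ell$ is odd, and $\gcd(n-1,\ell)\ne 1$. Then $\max(n,\ell)=\binom{n}{2}-\left(\frac{n}{2}+1\right)$, and the complement of $C_3\cup\left(\frac{n-4}{2}\right)P_2\cup K_1$ is an $(n,\ell)$-extremal graph.
   Context: All graphs are finite and simple; labels lie in $\mathbb{Z}_\ell$. In the neighborhood Lights Out game on a graph $G$, each vertex carries a label in $\mathbb{Z}_\ell$; toggling a vertex $v$ adds $1$ (mod $\ell$) to the label of every vertex of the closed neighborhood $N[v]$; the game is won when all labels are $0$. $G$ is $N$-AW if the game can be won from every initial labeling. $\max(n,\ell)$ is the maximum number of edges of an $N$-AW graph on $n$ vertices; an $(n,\ell)$-extremal graph is an $N$-AW graph on $n$ vertices with $\max(n,\ell)$ edges. $C_3$ is the triangle, $P_2$ a single edge, $K_1$ a single vertex, $kG$ denotes $k$ disjoint copies of $G$, and $\cup$ denotes disjoint union. -}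

module Defs where

open import Data.Bool using (Bool; true; false; not; _∧_; if_then_else_)
open import Data.Nat using (ℕ; zero; suc; _+_; _∸_; _≡ᵇ_; _<ᵇ_; ⌊_/2⌋)
open import Data.Nat.Divisibility using (_∣_)
open import Data.Fin using (Fin; toℕ)
open import Data.Product using (Σ)
open import Relation.Binary.PropositionalEquality using (_≡_; refl; cong)

record Graph (n : ℕ) : Set where
  field
    adj   : Fin n → Fin n → Bool
    sym   : ∀ i j → adj i j ≡ adj j i
    irref : ∀ i → adj i i ≡ false
open Graph public

Σ[_] : ∀ n → (Fin n → ℕ) → ℕ
Σ[ zero ] f = 0
Σ[ suc n ] f = f Fin.zero + Σ[ n ] (λ i → f (Fin.suc i))


b2n : Bool → ℕ
b2n true  = 1
b2n false = 0

edges : ∀ {n} → Graph n → ℕ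
edges {n} G = Σ[ n ] λ i → Σ[ n ] λ j → b2n ((toℕ i <ᵇ toℕ j) ∧ adj G i j)

inN : ∀ {n} → Graph n → Fin n → Fin n → Bool
inN G v u = if toℕ u ≡ᵇ toℕ v then true else adj G v u

-- Neighborhood Lights Out over ℤ_ℓ.  x u = number of times vertex u is
-- toggled (order is irrelevant, toggles commute).
Wins : ∀ {n} (ℓ : ℕ) → Graph n → (Fin n → Fin ℓ) → (Fin n → ℕ) → Set
Wins {n} ℓ G c x =
  ∀ v → ℓ ∣ (toℕ (c v) + Σ[ n ] (λ u → if inN G v u then x u else 0))

N-AW : ∀ {n} (ℓ : ℕ) → Graph n → Set
N-AW {n} ℓ G = ∀ (c : Fin n → Fin ℓ) → Σ (Fin n → ℕ) (λ x → Wins ℓ G c x)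

≡ᵇ-sym : ∀ a b → (a ≡ᵇ b) ≡ (b ≡ᵇ a)
≡ᵇ-sym zero zero = refl
≡ᵇ-sym zero (suc b) = refl
≡ᵇ-sym (suc a) zero = refl
≡ᵇ-sym (suc a) (suc b) = ≡ᵇ-sym a b

≡ᵇ-refl : ∀ a → (a ≡ᵇ a) ≡ true
≡ᵇ-refl zero = refl
≡ᵇ-refl (suc a) = ≡ᵇ-refl a

complement : ∀ {n} → Graph n → Graph n
complement G = record
  { adj   = λ i j → not (toℕ i ≡ᵇ toℕ j) ∧ not (adj G i j)
  ; sym   = λ i j → cong₂' (≡ᵇ-sym (toℕ i) (toℕ j)) (sym G i j)
  ; irref = λ i → cong (λ b → not b ∧ not (adj G i i)) (≡ᵇ-refl (toℕ i))
  }
  where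
  cong₂' : ∀ {a b c d} → a ≡ b → c ≡ d → not a ∧ not c ≡ not b ∧ not d
  cong₂' refl refl = refl

cliques : ∀ {n} → (Fin n → ℕ) → Graph n
cliques blk = record
  { adj   = λ i j → not (toℕ i ≡ᵇ toℕ j) ∧ (blk i ≡ᵇ blk j)
  ; sym   = λ i j → c2 (≡ᵇ-sym (toℕ i) (toℕ j)) (≡ᵇ-sym (blk i) (blk j))
  ; irref = λ i → cong (λ b → not b ∧ (blk i ≡ᵇ blk i)) (≡ᵇ-refl (toℕ i))
  }
  where
  c2 : ∀ {a b c d} → a ≡ b → c ≡ d → not a ∧ c ≡ not b ∧ d
  c2 refl refl = refl

-- C₃ ∪ ((n-4)/2) P₂ ∪ K₁ on vertex set {0,…,n-1} (n ≥ 4 even):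
-- vertices 0,1,2 form the triangle (label 0); vertices 3..n-2 are paired
-- as {3,4},{5,6},… (label ⌊(i-1)/2⌋ ≥ 1, < n); vertex n-1 is isolated
-- (label n, unique).
C3∪P2s∪K1-block : ∀ n → Fin n → ℕ
C3∪P2s∪K1-block n i =
  if toℕ i <ᵇ 3 then 0
  else if toℕ i ≡ᵇ (n ∸ 1) then n
  else ⌊ toℕ i ∸ 1 /2⌋

C3∪P2s∪K1 : ∀ n → Graph n
C3∪P2s∪K1 n = cliques (C3∪P2s∪K1-block n)

-- Upper bound: let H be the complement of an N-AW graph G on n vertices, n even, and
-- suppose 2|E(H)| ≤ n. Counting degrees, H either has two vertices with the same
-- neighbourhood (two isolated vertices, or two leaves at a vertex of degree 2), or it is
-- a perfect matching. In the first case the two vertices have the same closed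
-- neighbourhood in G, so a single light on one of them cannot be switched off. In the
-- second every closed neighbourhood of G has n - 1 vertices; summing all equations for a
-- single light shows that every common divisor of n - 1 and ℓ divides 1.
--
-- Extremal graph: in the complement of a disjoint union of cliques the closed
-- neighbourhood of v is everything outside v's clique, plus v. The game then decouples
-- clique by clique and is solved explicitly over ℤ; the isolated vertex fixes the total
-- number of toggles, and on the triangle one divides by 2, which is possible as ℓ is odd.

module Submission where

open import Defs
open import Algebra.Bundles using (Monoid)
open import Data.Nat.Combinatorics using (_C_; nC1≡n; nCk+nC[k+1]≡[n+1]C[k+1])
open import Data.Bool using (Bool; true; false; not; _∧_; if_then_else_)
open import Data.Empty using (⊥-elim)
open import Data.Fin using (Fin; toℕ; fromℕ<)
import Data.Fin as Fin
open import Data.Fin.Properties using (toℕ-injective; toℕ-fromℕ<; any?)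
open import Data.Nat using (ℕ; zero; suc; _≡ᵇ_; _<ᵇ_; NonZero)
open import Data.Nat.Properties hiding (_≟_)
import Data.Nat as ℕ
open import Data.Product using (Σ; _,_; _×_; ∃; proj₁; proj₂)
open import Function using (_∘_; _⇔_; mk⇔; Equivalence; case_of_)
open import Relation.Binary.PropositionalEquality
  using (_≡_; _≢_; refl; cong; cong₂; trans; subst; subst₂; module ≡-Reasoning)
  renaming (sym to ≡-sym)
open import Relation.Nullary using (¬_; proof; yes; no; ¬?; _×-dec_)
open import Data.Sum using (_⊎_; inj₁; inj₂; [_,_])
open import Relation.Nullary.Reflects using (Reflects; ofʸ; ofⁿ)

open import Algebra.Properties.Semiring.Sum +-*-semiring
  using (sum; sum-syntax; sum-cong-≗; sum-replicate-zero; ∑-distrib-+; ∑-comm; *-distribˡ-sum)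

module _ where
  open import Data.Nat using (_+_; _*_; _∸_; _≤_; _<_; z≤n; s≤s; s≤s⁻¹; z<s)
  open import Data.Nat.Divisibility
    using (_∣_; divides; _∣0; ∣m∣n⇒∣m+n; ∣m+n∣m⇒∣n; ∣n⇒∣m*n; ∣1⇒≡1; ∣-trans)

  ≡ᵇ-reflects : ∀ m n → Reflects (m ≡ n) (m ≡ᵇ n)
  ≡ᵇ-reflects m n = proof (m ℕ.≟ n)

  toℕ-≡ᵇ-reflects : ∀ {n} (u v : Fin n) → Reflects (u ≡ v) (toℕ u ≡ᵇ toℕ v)
  toℕ-≡ᵇ-reflects u v with toℕ u ≡ᵇ toℕ v | ≡ᵇ-reflects (toℕ u) (toℕ v)
  ... | true  | ofʸ u≡v = ofʸ (toℕ-injective u≡v)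
  ... | false | ofⁿ u≢v = ofⁿ (u≢v ∘ cong toℕ)

  ≢⇒≡ᵇ-false : ∀ {m n} → m ≢ n → (m ≡ᵇ n) ≡ false
  ≢⇒≡ᵇ-false {m} {n} m≢n with m ≡ᵇ n | ≡ᵇ-reflects m n
  ... | false | _       = refl
  ... | true  | ofʸ m≡n = ⊥-elim (m≢n m≡n)

  Σ≡sum : ∀ n (f : Fin n → ℕ) → Σ[ n ] f ≡ sum f
  Σ≡sum zero    f = refl
  Σ≡sum (suc n) f = cong (f Fin.zero +_) (Σ≡sum n (f ∘ Fin.suc))

  module _ {a ℓ} (M : Monoid a ℓ) where
    open Monoid M using (Carrier; _≈_; setoid; ∙-congˡ; identityˡ; identityʳ)
      renaming (_∙_ to _⊕_; ε to 0#)
    open import Algebra.Properties.Monoid.Sum M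
      using () renaming (sum to ∑; sum-replicate-zero to ∑-replicate-zero)
    open import Relation.Binary.Reasoning.Setoid setoid

    sum-indicator : ∀ {n} (f : Fin n → Carrier) (v : Fin n) →
      ∑ (λ u → if toℕ u ≡ᵇ toℕ v then f u else 0#) ≈ f v
    sum-indicator {suc n} f Fin.zero = begin
      f Fin.zero ⊕ ∑ {n} (λ _ → 0#) ≈⟨ ∙-congˡ (∑-replicate-zero n) ⟩
      f Fin.zero ⊕ 0#           ≈⟨ identityʳ _ ⟩
      f Fin.zero                ∎
    sum-indicator {suc n} f (Fin.suc v) = begin
      0# ⊕ ∑ (λ u → if toℕ u ≡ᵇ toℕ v then f (Fin.suc u) else 0#) ≈⟨ identityˡ _ ⟩
      ∑ (λ u → if toℕ u ≡ᵇ toℕ v then f (Fin.suc u) else 0#)      ≈⟨ sum-indicator (f ∘ Fin.suc) v ⟩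
      f (Fin.suc v)                                               ∎

  sum-ones : ∀ n → sum {n} (λ _ → 1) ≡ n
  sum-ones zero    = refl
  sum-ones (suc n) = cong suc (sum-ones n)

  ≤-sum : ∀ {n} (f : Fin n → ℕ) i → f i ≤ sum f
  ≤-sum f Fin.zero    = m≤m+n _ _
  ≤-sum f (Fin.suc i) = ≤-trans (≤-sum (f ∘ Fin.suc) i) (m≤n+m _ _)

  sum-squeeze : ∀ {n} {f g : Fin n → ℕ} → (∀ i → g i ≤ f i) → sum f ≤ sum g → ∀ i → f i ≡ g i
  sum-squeeze {n} {f} {g} g≤f Σf≤Σg i =
    ≤-antisym (m∸n≡0⇒m≤n (n≤0⇒n≡0 (≤-trans (≤-sum excess i) Σexcess≤0))) (g≤f i)
    where
    excess : Fin n → ℕ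
    excess j = f j ∸ g j
    Σf≡Σexcess+Σg : sum f ≡ sum excess + sum g
    Σf≡Σexcess+Σg = trans (sum-cong-≗ (λ j → ≡-sym (m∸n+n≡m (g≤f j)))) (∑-distrib-+ excess g)
    Σexcess≤0 : sum excess ≤ 0
    Σexcess≤0 = +-cancelʳ-≤ (sum g) _ 0 (subst (_≤ sum g) Σf≡Σexcess+Σg Σf≤Σg)

  b2n+b2n-not : ∀ b → b2n b + b2n (not b) ≡ 1
  b2n+b2n-not true  = refl
  b2n+b2n-not false = refl

  b2n-if : ∀ b → b2n b ≡ (if b then 1 else 0)
  b2n-if true  = refl
  b2n-if false = refl

  count-indicator : ∀ {n} (v : Fin n) → ∑[ u < n ] b2n (toℕ u ≡ᵇ toℕ v) ≡ 1
  count-indicator {n} v =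
    trans (sum-cong-≗ {n} (λ u → b2n-if (toℕ u ≡ᵇ toℕ v)))
          (sum-indicator +-0-monoid {n} (λ _ → 1) v)

  count-others : ∀ {n} (v : Fin n) → ∑[ u < n ] b2n (not (toℕ u ≡ᵇ toℕ v)) + 1 ≡ n
  count-others {n} v = begin
    sum others + 1                  ≡⟨ cong (sum others +_) (count-indicator v) ⟨
    sum others + sum at-v           ≡⟨ ∑-distrib-+ others at-v ⟨
    sum (λ u → others u + at-v u)   ≡⟨ sum-cong-≗ {n} (λ u →
                                         trans (+-comm (others u) (at-v u)) (b2n+b2n-not (toℕ u ≡ᵇ toℕ v))) ⟩
    sum {n} (λ _ → 1)               ≡⟨ sum-ones n ⟩
    n                               ∎
    where
    open ≡-Reasoning
    at-v others : Fin n → ℕ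
    at-v   u = b2n (toℕ u ≡ᵇ toℕ v)
    others u = b2n (not (toℕ u ≡ᵇ toℕ v))

  witness : ∀ {n} (P : Fin n → Bool) → 1 ≤ sum (b2n ∘ P) → ∃ λ a → P a ≡ true
  witness {suc n} P 1≤ΣP with P Fin.zero in P0
  ... | true  = Fin.zero , P0
  ... | false with a , Pa ← witness (P ∘ Fin.suc) 1≤ΣP = Fin.suc a , Pa

  two-witnesses : ∀ {n} (P : Fin n → Bool) → 2 ≤ sum (b2n ∘ P) →
    Σ (Fin n) λ a → Σ (Fin n) λ c → a ≢ c × P a ≡ true × P c ≡ true
  two-witnesses {suc n} P 2≤ΣP with P Fin.zero in P0
  ... | true with c , Pc ← witness (P ∘ Fin.suc) (s≤s⁻¹ 2≤ΣP) =
    Fin.zero , Fin.suc c , (λ ()) , P0 , Pc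
  ... | false with a , c , a≢c , Pa , Pc ← two-witnesses (P ∘ Fin.suc) 2≤ΣP =
    Fin.suc a , Fin.suc c , a≢c ∘ Data.Fin.Properties.suc-injective , Pa , Pc

  degree : ∀ {n} → Graph n → Fin n → ℕ
  degree {n} G v = ∑[ u < n ] b2n (adj G v u)

  adj-irrefl : ∀ {n} (G : Graph n) {i j} → toℕ i ≡ toℕ j → adj G i j ≡ false
  adj-irrefl G {i} i≡j = subst (λ j → adj G i j ≡ false) (toℕ-injective i≡j) (irref G i)

  b2n-adj-split : ∀ {n} (G : Graph n) i j →
    b2n (adj G i j) ≡ b2n ((toℕ i <ᵇ toℕ j) ∧ adj G i j) + b2n ((toℕ j <ᵇ toℕ i) ∧ adj G i j)
  b2n-adj-split G i j
    with toℕ i <ᵇ toℕ j | <ᵇ-reflects-< (toℕ i) (toℕ j)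
       | toℕ j <ᵇ toℕ i | <ᵇ-reflects-< (toℕ j) (toℕ i)
  ... | true  | ofʸ i<j | true  | ofʸ j<i = ⊥-elim (<-asym i<j j<i)
  ... | true  | _       | false | _       = ≡-sym (+-identityʳ _)
  ... | false | _       | true  | _       = refl
  ... | false | ofⁿ i≮j | false | ofⁿ j≮i = cong b2n (adj-irrefl G (≤-antisym (≮⇒≥ j≮i) (≮⇒≥ i≮j)))

  edges≡sum : ∀ {n} (G : Graph n) →
    edges G ≡ ∑[ i < n ] ∑[ j < n ] b2n ((toℕ i <ᵇ toℕ j) ∧ adj G i j)
  edges≡sum {n} G = trans (Σ≡sum n _) (sum-cong-≗ {n} (λ i → Σ≡sum n _))

  handshake : ∀ {n} (G : Graph n) → ∑[ v < n ] degree G v ≡ edges G + edges G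
  handshake {n} G = begin
    ∑[ i < n ] ∑[ j < n ] b2n (adj G i j)
      ≡⟨ sum-cong-≗ {n} (λ i → trans (sum-cong-≗ {n} (b2n-adj-split G i))
                                       (∑-distrib-+ (forward i) (backward i))) ⟩
    ∑[ i < n ] (∑[ j < n ] forward i j + ∑[ j < n ] backward i j)
      ≡⟨ ∑-distrib-+ (λ i → ∑[ j < n ] forward i j) (λ i → ∑[ j < n ] backward i j) ⟩
    ∑[ i < n ] ∑[ j < n ] forward i j + ∑[ i < n ] ∑[ j < n ] backward i j
      ≡⟨ cong (Σforward +_) (∑-comm backward) ⟩
    ∑[ i < n ] ∑[ j < n ] forward i j + ∑[ j < n ] ∑[ i < n ] backward i j
      ≡⟨ cong (Σforward +_) (sum-cong-≗ {n} λ j → sum-cong-≗ {n} λ i →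
           cong (λ b → b2n ((toℕ j <ᵇ toℕ i) ∧ b)) (sym G i j)) ⟩
    ∑[ i < n ] ∑[ j < n ] forward i j + ∑[ j < n ] ∑[ i < n ] forward j i
      ≡⟨ cong₂ _+_ (edges≡sum G) (edges≡sum G) ⟨
    edges G + edges G ∎
    where
    open ≡-Reasoning
    forward backward : Fin n → Fin n → ℕ
    forward  i j = b2n ((toℕ i <ᵇ toℕ j) ∧ adj G i j)
    backward i j = b2n ((toℕ j <ᵇ toℕ i) ∧ adj G i j)
    Σforward : ℕ
    Σforward = ∑[ i < n ] ∑[ j < n ] forward i j

  count-pairs : ∀ n → ∑[ i < n ] ∑[ j < n ] b2n (toℕ i <ᵇ toℕ j) ≡ n C 2
  count-pairs zero    = refl
  count-pairs (suc n) = begin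
    ∑[ j < n ] 1 + ∑[ i < n ] ∑[ j < n ] b2n (toℕ i <ᵇ toℕ j)
      ≡⟨ cong₂ _+_ (sum-ones n) (count-pairs n) ⟩
    n + n C 2
      ≡⟨ cong (_+ n C 2) (nC1≡n n) ⟨
    n C 1 + n C 2
      ≡⟨ nCk+nC[k+1]≡[n+1]C[k+1] n 1 ⟩
    suc n C 2 ∎
    where open ≡-Reasoning

  edges+edges-complement : ∀ {n} (G : Graph n) → edges G + edges (complement G) ≡ n C 2
  edges+edges-complement {n} G = begin
    edges G + edges (complement G)
      ≡⟨ cong₂ _+_ (edges≡sum G) (edges≡sum (complement G)) ⟩
    ∑[ i < n ] ∑[ j < n ] inG i j + ∑[ i < n ] ∑[ j < n ] inH i j
      ≡⟨ ∑-distrib-+ (λ i → ∑[ j < n ] inG i j) (λ i → ∑[ j < n ] inH i j) ⟨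
    ∑[ i < n ] (∑[ j < n ] inG i j + ∑[ j < n ] inH i j)
      ≡⟨ sum-cong-≗ {n} (λ i → trans (≡-sym (∑-distrib-+ (inG i) (inH i)))
                                       (sum-cong-≗ {n} (split i))) ⟩
    ∑[ i < n ] ∑[ j < n ] b2n (toℕ i <ᵇ toℕ j)
      ≡⟨ count-pairs n ⟩
    n C 2 ∎
    where
    open ≡-Reasoning
    inG inH : Fin n → Fin n → ℕ
    inG i j = b2n ((toℕ i <ᵇ toℕ j) ∧ adj G i j)
    inH i j = b2n ((toℕ i <ᵇ toℕ j) ∧ adj (complement G) i j)
    split : ∀ i j → inG i j + inH i j ≡ b2n (toℕ i <ᵇ toℕ j)
    split i j with toℕ i <ᵇ toℕ j | <ᵇ-reflects-< (toℕ i) (toℕ j)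
    ... | false | _       = refl
    ... | true  | ofʸ i<j rewrite ≢⇒≡ᵇ-false (<⇒≢ i<j) = b2n+b2n-not (adj G i j)

  inN≡not-adj-complement : ∀ {n} (G : Graph n) v u → inN G v u ≡ not (adj (complement G) v u)
  inN≡not-adj-complement G v u rewrite ≡ᵇ-sym (toℕ v) (toℕ u) with toℕ u ≡ᵇ toℕ v
  ... | true  = refl
  ... | false with adj G v u
  ...   | true  = refl
  ...   | false = refl

  inN-sym : ∀ {n} (G : Graph n) v u → inN G v u ≡ inN G u v
  inN-sym G v u rewrite ≡ᵇ-sym (toℕ u) (toℕ v) | sym G v u = refl

  closed-neighbourhood-size : ∀ {n} (G : Graph n) v →
    ∑[ u < n ] b2n (inN G v u) + degree (complement G) v ≡ n
  closed-neighbourhood-size {n} G v = begin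
    ∑[ u < n ] b2n (inN G v u) + degree (complement G) v
      ≡⟨ ∑-distrib-+ (b2n ∘ inN G v) (b2n ∘ adj (complement G) v) ⟨
    ∑[ u < n ] (b2n (inN G v u) + b2n (adj (complement G) v u))
      ≡⟨ sum-cong-≗ {n} closed+open ⟩
    ∑[ u < n ] 1
      ≡⟨ sum-ones n ⟩
    n ∎
    where
    open ≡-Reasoning
    closed+open : ∀ u → b2n (inN G v u) + b2n (adj (complement G) v u) ≡ 1
    closed+open u rewrite inN≡not-adj-complement G v u =
      trans (+-comm (b2n (not (adj (complement G) v u))) _) (b2n+b2n-not (adj (complement G) v u))

  toggleSum : ∀ {n} → Graph n → (Fin n → ℕ) → Fin n → ℕ
  toggleSum {n} G x v = ∑[ u < n ] (if inN G v u then x u else 0)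

  Wins⇔ : ∀ {n ℓ} (G : Graph n) c x →
    Wins ℓ G c x ⇔ (∀ v → ℓ ∣ toℕ (c v) + toggleSum G x v)
  Wins⇔ {n} {ℓ} G c x = mk⇔
    (λ win v → subst (λ s → ℓ ∣ toℕ (c v) + s) (Σ≡sum n _) (win v))
    (λ win v → subst (λ s → ℓ ∣ toℕ (c v) + s) (≡-sym (Σ≡sum n _)) (win v))

  pointLight : ∀ {n ℓ} → 1 < ℓ → Fin n → Fin n → Fin ℓ
  pointLight 1<ℓ v u = if toℕ u ≡ᵇ toℕ v then fromℕ< 1<ℓ else fromℕ< (<-trans z<s 1<ℓ)

  toℕ-pointLight : ∀ {n ℓ} (1<ℓ : 1 < ℓ) (v u : Fin n) →
    toℕ (pointLight 1<ℓ v u) ≡ b2n (toℕ u ≡ᵇ toℕ v)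
  toℕ-pointLight 1<ℓ v u with toℕ u ≡ᵇ toℕ v
  ... | true  = toℕ-fromℕ< 1<ℓ
  ... | false = toℕ-fromℕ< (<-trans z<s 1<ℓ)

  twins⇒¬N-AW : ∀ {n ℓ} (G : Graph n) {v w} → 1 < ℓ → v ≢ w →
    (∀ u → inN G v u ≡ inN G w u) → ¬ N-AW ℓ G
  twins⇒¬N-AW {n} {ℓ} G {v} {w} 1<ℓ v≢w same aw = <⇒≢ 1<ℓ (≡-sym (∣1⇒≡1 ℓ∣1))
    where
    x = proj₁ (aw (pointLight 1<ℓ v))
    win = Equivalence.to (Wins⇔ G _ x) (proj₂ (aw (pointLight 1<ℓ v)))
    light-v : toℕ (pointLight 1<ℓ v v) ≡ 1
    light-v = trans (toℕ-pointLight 1<ℓ v v) (cong b2n (≡ᵇ-refl (toℕ v)))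
    light-w : toℕ (pointLight 1<ℓ v w) ≡ 0
    light-w = trans (toℕ-pointLight 1<ℓ v w) (cong b2n (≢⇒≡ᵇ-false (v≢w ∘ toℕ-injective ∘ ≡-sym)))
    same-sum : toggleSum G x v ≡ toggleSum G x w
    same-sum = sum-cong-≗ {n} (λ u → cong (λ b → if b then x u else 0) (same u))
    ℓ∣1 : ℓ ∣ 1
    ℓ∣1 = ∣m+n∣m⇒∣n
      (subst (ℓ ∣_) (trans (cong₂ _+_ light-v same-sum) (+-comm 1 (toggleSum G x w))) (win v))
      (subst (ℓ ∣_) (cong (_+ toggleSum G x w) light-w) (win w))

  ∣-sum : ∀ {d n} (f : Fin n → ℕ) → (∀ i → d ∣ f i) → d ∣ sum f
  ∣-sum {d} {zero}  f d∣f = d ∣0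
  ∣-sum {d} {suc n} f d∣f = ∣m∣n⇒∣m+n (d∣f Fin.zero) (∣-sum (f ∘ Fin.suc) (d∣f ∘ Fin.suc))

  if≡*b2n : ∀ b x → (if b then x else 0) ≡ x * b2n b
  if≡*b2n true  x = ≡-sym (*-identityʳ x)
  if≡*b2n false x = ≡-sym (*-zeroʳ x)

  sum-toggleSum : ∀ {n} (G : Graph n) x →
    ∑[ v < n ] toggleSum G x v ≡ ∑[ u < n ] (x u * ∑[ v < n ] b2n (inN G u v))
  sum-toggleSum {n} G x = begin
    ∑[ v < n ] ∑[ u < n ] (if inN G v u then x u else 0)
      ≡⟨ ∑-comm (λ v u → if inN G v u then x u else 0) ⟩
    ∑[ u < n ] ∑[ v < n ] (if inN G v u then x u else 0)
      ≡⟨ sum-cong-≗ {n} (λ u → sum-cong-≗ {n} (λ v → lighter u v)) ⟩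
    ∑[ u < n ] ∑[ v < n ] (x u * b2n (inN G u v))
      ≡⟨ sum-cong-≗ {n} (λ u → *-distribˡ-sum (x u) (b2n ∘ inN G u)) ⟨
    ∑[ u < n ] (x u * ∑[ v < n ] b2n (inN G u v)) ∎
    where
    open ≡-Reasoning
    lighter : ∀ u v → (if inN G v u then x u else 0) ≡ x u * b2n (inN G u v)
    lighter u v = trans (if≡*b2n (inN G v u) (x u)) (cong (λ b → x u * b2n b) (inN-sym G v u))

  divisible-neighbourhoods⇒¬N-AW : ∀ {n ℓ d} (G : Graph n) → Fin n → 1 < ℓ → d ∣ ℓ → d ≢ 1 →
    (∀ v → d ∣ ∑[ u < n ] b2n (inN G v u)) → ¬ N-AW ℓ G
  divisible-neighbourhoods⇒¬N-AW {n} {ℓ} {d} G v₀ 1<ℓ d∣ℓ d≢1 d∣N aw = d≢1 (∣1⇒≡1 d∣1)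
    where
    c = pointLight 1<ℓ v₀
    x = proj₁ (aw c)
    win = Equivalence.to (Wins⇔ G c x) (proj₂ (aw c))
    total : ∑[ v < n ] (toℕ (c v) + toggleSum G x v)
          ≡ 1 + ∑[ u < n ] (x u * ∑[ v < n ] b2n (inN G u v))
    total = trans (∑-distrib-+ (toℕ ∘ c) (toggleSum G x))
      (cong₂ _+_ (trans (sum-cong-≗ {n} (toℕ-pointLight 1<ℓ v₀)) (count-indicator v₀))
                 (sum-toggleSum G x))
    d∣1 : d ∣ 1
    d∣1 = ∣m+n∣m⇒∣n
      (subst (d ∣_) (trans total (+-comm 1 _)) (∣-sum _ (λ v → ∣-trans d∣ℓ (win v))))
      (∣-sum _ (λ u → ∣n⇒∣m*n (x u) (d∣N u)))

  SameNeighbours : ∀ {n} → Graph n → Fin n → Fin n → Set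
  SameNeighbours H a c = ∀ u → adj H a u ≡ adj H c u

  FalseTwins : ∀ {n} → Graph n → Set
  FalseTwins {n} H = Σ (Fin n) λ a → Σ (Fin n) λ c → a ≢ c × SameNeighbours H a c

  b2n-injective : ∀ {a b} → b2n a ≡ b2n b → a ≡ b
  b2n-injective {true}  {true}  _ = refl
  b2n-injective {false} {false} _ = refl

  b2n≤1 : ∀ b → b2n b ≤ 1
  b2n≤1 true  = ≤-refl
  b2n≤1 false = z≤n

  degree-zero⇒adj-false : ∀ {n} (H : Graph n) {v} → degree H v ≡ 0 → ∀ u → adj H v u ≡ false
  degree-zero⇒adj-false H {v} deg≡0 u =
    b2n-injective (n≤0⇒n≡0 (subst (b2n (adj H v u) ≤_) deg≡0 (≤-sum (b2n ∘ adj H v) u)))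

  degree-one⇒adj-indicator : ∀ {n} (H : Graph n) {a b} → degree H a ≡ 1 → adj H a b ≡ true →
    ∀ u → adj H a u ≡ (toℕ u ≡ᵇ toℕ b)
  degree-one⇒adj-indicator {n} H {a} {b} deg≡1 ab u =
    b2n-injective (sum-squeeze at-b≤adj (≤-reflexive (trans deg≡1 (≡-sym (count-indicator b)))) u)
    where
    at-b≤adj : ∀ u → b2n (toℕ u ≡ᵇ toℕ b) ≤ b2n (adj H a u)
    at-b≤adj u with toℕ u ≡ᵇ toℕ b | toℕ-≡ᵇ-reflects u b
    ... | true  | ofʸ refl = ≤-reflexive (cong b2n (≡-sym ab))
    ... | false | _        = z≤n

  no-isolated⇒1-regular : ∀ {n} (H : Graph n) → edges H + edges H ≤ n →
    (∀ v → degree H v ≢ 0) → ∀ v → degree H v ≡ 1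
  no-isolated⇒1-regular {n} H sparse ¬isolated = sum-squeeze {g = λ _ → 1}
    (n≢0⇒n>0 ∘ ¬isolated)
    (subst₂ _≤_ (≡-sym (handshake H)) (≡-sym (sum-ones n)) sparse)

  2∣m+m : ∀ m → 2 ∣ m + m
  2∣m+m m = divides m (trans (cong (m +_) (≡-sym (+-identityʳ m))) (*-comm 2 m))

  module _ {n} (H : Graph n) {v : Fin n} (isolated : degree H v ≡ 0)
           (others-not-isolated : ∀ w → w ≢ v → degree H w ≢ 0) where

    private
      outside : Fin n → ℕ
      outside u = b2n (not (toℕ u ≡ᵇ toℕ v))

      outside≤degree : ∀ u → outside u ≤ degree H u
      outside≤degree u with toℕ u ≡ᵇ toℕ v | toℕ-≡ᵇ-reflects u v
      ... | true  | _       = z≤n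
      ... | false | ofⁿ u≢v = n≢0⇒n>0 (others-not-isolated u u≢v)

    degrees≤1⇒edges-odd : (∀ b → ¬ 2 ≤ degree H b) → edges H + edges H + 1 ≡ n
    degrees≤1⇒edges-odd ¬branch = begin
      edges H + edges H + 1      ≡⟨ cong (_+ 1) (handshake H) ⟨
      ∑[ u < n ] degree H u + 1  ≡⟨ cong (_+ 1) (sum-cong-≗ {n} degree≡outside) ⟩
      ∑[ u < n ] outside u + 1   ≡⟨ count-others v ⟩
      n                          ∎
      where
      open ≡-Reasoning
      degree≡outside : ∀ u → degree H u ≡ outside u
      degree≡outside u with toℕ u ≡ᵇ toℕ v | toℕ-≡ᵇ-reflects u v
      ... | true  | ofʸ refl = isolated
      ... | false | ofⁿ u≢v =
        ≤-antisym (s≤s⁻¹ (≰⇒> (¬branch u))) (n≢0⇒n>0 (others-not-isolated u u≢v))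

    branch⇒twins : edges H + edges H ≤ n → ∀ {b} → 2 ≤ degree H b → FalseTwins H
    branch⇒twins sparse {b} 2≤deg-b with a , c , a≢c , ba , bc ← two-witnesses (adj H b) 2≤deg-b =
      a , c , a≢c , λ u → trans (leaf ba u) (≡-sym (leaf bc u))
      where
      at-b : Fin n → ℕ
      at-b u = b2n (toℕ u ≡ᵇ toℕ b)

      lower≤degree : ∀ u → outside u + at-b u ≤ degree H u
      lower≤degree u with toℕ u ≡ᵇ toℕ b | toℕ-≡ᵇ-reflects u b
      ... | true  | ofʸ refl = ≤-trans (+-monoˡ-≤ 1 (b2n≤1 (not (toℕ b ≡ᵇ toℕ v)))) 2≤deg-b
      ... | false | _        = subst (_≤ degree H u) (≡-sym (+-identityʳ _)) (outside≤degree u)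

      degree≡lower : ∀ u → degree H u ≡ outside u + at-b u
      degree≡lower = sum-squeeze lower≤degree (begin
        ∑[ u < n ] degree H u                   ≡⟨ handshake H ⟩
        edges H + edges H                       ≤⟨ sparse ⟩
        n                                       ≡⟨ count-others v ⟨
        ∑[ u < n ] outside u + 1                ≡⟨ cong (sum outside +_) (count-indicator b) ⟨
        ∑[ u < n ] outside u + ∑[ u < n ] at-b u ≡⟨ ∑-distrib-+ outside at-b ⟨
        ∑[ u < n ] (outside u + at-b u)         ∎)
        where open ≤-Reasoning

      leaf : ∀ {x} → adj H b x ≡ true → ∀ u → adj H x u ≡ (toℕ u ≡ᵇ toℕ b)
      leaf {x} bx = degree-one⇒adj-indicator H (begin
        degree H x             ≡⟨ degree≡lower x ⟩
        outside x + at-b x     ≡⟨ cong₂ (λ p q → b2n (not p) + b2n q)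
                                        (≢⇒≡ᵇ-false x≢v) (≢⇒≡ᵇ-false x≢b) ⟩
        1                      ∎) xb
        where
        open ≡-Reasoning
        xb : adj H x b ≡ true
        xb = trans (sym H x b) bx
        x≢v : toℕ x ≢ toℕ v
        x≢v x≡v = case trans (≡-sym (degree-zero⇒adj-false H isolated b))
                             (subst (λ y → adj H y b ≡ true) (toℕ-injective x≡v) xb) of λ ()
        x≢b : toℕ x ≢ toℕ b
        x≢b x≡b = case trans (≡-sym bx) (adj-irrefl H (≡-sym x≡b)) of λ ()

    unique-isolated⇒twins : 2 ∣ n → edges H + edges H ≤ n → FalseTwins H
    unique-isolated⇒twins 2∣n sparse with any? (λ b → 2 ℕ.≤? degree H b)
    ... | yes (b , 2≤deg-b) = branch⇒twins sparse 2≤deg-b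
    ... | no ¬branch = ⊥-elim (2≢1 (∣1⇒≡1 (∣m+n∣m⇒∣n 2∣2e+1 (2∣m+m (edges H)))))
      where
      2∣2e+1 : 2 ∣ edges H + edges H + 1
      2∣2e+1 = subst (2 ∣_) (≡-sym (degrees≤1⇒edges-odd (λ b 2≤deg-b → ¬branch (b , 2≤deg-b)))) 2∣n
      2≢1 : 2 ≢ 1
      2≢1 ()

  sparse-graph-dichotomy : ∀ {n} (H : Graph n) → 2 ∣ n → edges H + edges H ≤ n →
    FalseTwins H ⊎ (∀ v → degree H v ≡ 1)
  sparse-graph-dichotomy H 2∣n sparse with any? (λ v → degree H v ℕ.≟ 0)
  ... | no ¬isolated = inj₂ (no-isolated⇒1-regular H sparse (λ v deg≡0 → ¬isolated (v , deg≡0)))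
  ... | yes (v , isolated) with any? (λ w → ¬? (w Fin.≟ v) ×-dec degree H w ℕ.≟ 0)
  ...   | yes (w , w≢v , isolated-w) = inj₁ (w , v , w≢v , λ u →
            trans (degree-zero⇒adj-false H isolated-w u)
                  (≡-sym (degree-zero⇒adj-false H isolated u)))
  ...   | no ¬other = inj₁ (unique-isolated⇒twins H isolated
            (λ w w≢v deg≡0 → ¬other (w , w≢v , deg≡0)) 2∣n sparse)

  falseTwins-complement⇒¬N-AW : ∀ {n ℓ} (G : Graph n) → 1 < ℓ →
    FalseTwins (complement G) → ¬ N-AW ℓ G
  falseTwins-complement⇒¬N-AW G 1<ℓ (a , c , a≢c , same) = twins⇒¬N-AW G 1<ℓ a≢c λ u → begin
    inN G a u                        ≡⟨ inN≡not-adj-complement G a u ⟩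
    not (adj (complement G) a u)     ≡⟨ cong not (same u) ⟩
    not (adj (complement G) c u)     ≡⟨ inN≡not-adj-complement G c u ⟨
    inN G c u                        ∎
    where open ≡-Reasoning

  N-AW⇒dense-complement : ∀ {n ℓ d} (G : Graph n) → 0 < n → 2 ∣ n →
    1 < ℓ → d ∣ ℓ → d ∣ n ∸ 1 → d ≢ 1 →
    N-AW ℓ G → n < edges (complement G) + edges (complement G)
  N-AW⇒dense-complement {n} G 0<n 2∣n 1<ℓ d∣ℓ d∣n-1 d≢1 aw = ≰⇒> λ sparse →
    [ (λ twins → falseTwins-complement⇒¬N-AW G 1<ℓ twins aw)
    , (λ regular → divisible-neighbourhoods⇒¬N-AW G (fromℕ< 0<n) 1<ℓ d∣ℓ d≢1
                     (λ v → subst (_ ∣_) (≡-sym (closed-size regular v)) d∣n-1) aw)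
    ] (sparse-graph-dichotomy (complement G) 2∣n sparse)
    where
    closed-size : (∀ v → degree (complement G) v ≡ 1) → ∀ v → ∑[ u < n ] b2n (inN G v u) ≡ n ∸ 1
    closed-size regular v = begin
      ∑[ u < n ] b2n (inN G v u)
        ≡⟨ m+n∸n≡m _ 1 ⟨
      ∑[ u < n ] b2n (inN G v u) + 1 ∸ 1
        ≡⟨ cong (λ k → ∑[ u < n ] b2n (inN G v u) + k ∸ 1) (regular v) ⟨
      ∑[ u < n ] b2n (inN G v u) + degree (complement G) v ∸ 1
        ≡⟨ cong (_∸ 1) (closed-neighbourhood-size G v) ⟩
      n ∸ 1 ∎
      where open ≡-Reasoning

  blockSize : ∀ {n} → (Fin n → ℕ) → ℕ → ℕ
  blockSize {n} blk k = ∑[ u < n ] b2n (blk u ≡ᵇ k)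

  degree-cliques : ∀ {n} (blk : Fin n → ℕ) v → degree (cliques blk) v + 1 ≡ blockSize blk (blk v)
  degree-cliques {n} blk v = begin
    degree (cliques blk) v + 1
      ≡⟨ cong (degree (cliques blk) v +_) (count-indicator v) ⟨
    degree (cliques blk) v + ∑[ u < n ] b2n (toℕ u ≡ᵇ toℕ v)
      ≡⟨ ∑-distrib-+ (b2n ∘ adj (cliques blk) v) (λ u → b2n (toℕ u ≡ᵇ toℕ v)) ⟨
    ∑[ u < n ] (b2n (adj (cliques blk) v u) + b2n (toℕ u ≡ᵇ toℕ v))
      ≡⟨ sum-cong-≗ {n} split ⟩
    blockSize blk (blk v) ∎
    where
    open ≡-Reasoning
    split : ∀ u → b2n (adj (cliques blk) v u) + b2n (toℕ u ≡ᵇ toℕ v) ≡ b2n (blk u ≡ᵇ blk v)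
    split u rewrite ≡ᵇ-sym (toℕ v) (toℕ u) | ≡ᵇ-sym (blk v) (blk u)
      with toℕ u ≡ᵇ toℕ v | toℕ-≡ᵇ-reflects u v
    ... | true  | ofʸ refl rewrite ≡ᵇ-refl (blk u) = refl
    ... | false | _        = +-identityʳ _

module _ where
  open import Data.Integer using (ℤ; +_; -_; _+_; _-_; _*_; 0ℤ; 1ℤ; _%ℕ_; _/ℕ_)
  import Data.Integer.Properties as ℤ
  open import Data.Integer.DivMod using (a≡a%ℕn+[a/ℕn]*n)
  open import Data.Integer.Divisibility.Signed using (_∣_; divides; ∣m∣n⇒∣m+n; ∣n⇒∣m*n; ∣⇒∣ᵤ)
  open import Data.Integer.Tactic.RingSolver using (solve-∀)
  open import Algebra.Properties.Semiring.Sum ℤ.+-*-semiring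
    using () renaming (sum to sumℤ; sum-cong-≗ to sumℤ-cong; ∑-distrib-+ to sumℤ-distrib-+;
                       *-distribʳ-sum to *-distribʳ-sumℤ)

  +-sum : ∀ {n} (f : Fin n → ℕ) → + sum f ≡ sumℤ (+_ ∘ f)
  +-sum {zero}  f = refl
  +-sum {suc n} f =
    trans (ℤ.pos-+ (f Fin.zero) (sum (f ∘ Fin.suc))) (cong (_+_ (+ f Fin.zero)) (+-sum (f ∘ Fin.suc)))

  +-if : ∀ b m → + (if b then m else 0) ≡ (if b then + m else 0ℤ)
  +-if true  m = refl
  +-if false m = refl

  +-toggleSum : ∀ {n} (G : Graph n) x v →
    + toggleSum G x v ≡ sumℤ (λ u → if inN G v u then + x u else 0ℤ)
  +-toggleSum {n} G x v = trans (+-sum (λ u → if inN G v u then x u else 0))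
                                (sumℤ-cong {n} (λ u → +-if (inN G v u) (x u)))

  if-+ : ∀ b (i j : ℤ) → (if b then i else 0ℤ) + (if b then j else 0ℤ) ≡ (if b then i + j else 0ℤ)
  if-+ true  i j = refl
  if-+ false i j = refl

  sumℤ-congruent : ∀ {d n} (f g : Fin n → ℤ) → (∀ i → d ∣ f i - g i) → d ∣ sumℤ f - sumℤ g
  sumℤ-congruent {d} {zero}  f g d∣f-g = divides 0ℤ refl
  sumℤ-congruent {d} {suc n} f g d∣f-g = subst (d ∣_) (regroup (f Fin.zero) (g Fin.zero) _ _)
    (∣m∣n⇒∣m+n (d∣f-g Fin.zero) (sumℤ-congruent (f ∘ Fin.suc) (g ∘ Fin.suc) (d∣f-g ∘ Fin.suc)))
    where
    regroup : ∀ a b s t → (a - b) + (s - t) ≡ (a + s) - (b + t)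
    regroup = solve-∀

  ∣%ℕ-difference : ∀ ℓ .{{_ : NonZero ℓ}} i → + ℓ ∣ + (i %ℕ ℓ) - i
  ∣%ℕ-difference ℓ i = divides (- (i /ℕ ℓ)) (begin
    + (i %ℕ ℓ) - i                            ≡⟨ cong (_-_ (+ (i %ℕ ℓ))) (a≡a%ℕn+[a/ℕn]*n i ℓ) ⟩
    + (i %ℕ ℓ) - (+ (i %ℕ ℓ) + i /ℕ ℓ * + ℓ) ≡⟨ cancel (+ (i %ℕ ℓ)) (i /ℕ ℓ) (+ ℓ) ⟩
    - (i /ℕ ℓ) * + ℓ                          ∎)
    where
    open ≡-Reasoning
    cancel : ∀ r q l → r - (r + q * l) ≡ - q * l
    cancel = solve-∀

  module _ {n} (blk : Fin n → ℕ) where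

    closedSum : (Fin n → ℤ) → Fin n → ℤ
    closedSum f v = sumℤ (λ u → if inN (complement (cliques blk)) v u then f u else 0ℤ)

    blockSum : (Fin n → ℤ) → ℕ → ℤ
    blockSum f k = sumℤ (λ u → if blk u ≡ᵇ k then f u else 0ℤ)

    blockSum-+ : ∀ f g k → blockSum f k + blockSum g k ≡ blockSum (λ u → f u + g u) k
    blockSum-+ f g k = trans (≡-sym (sumℤ-distrib-+ (restrict f) (restrict g)))
                             (sumℤ-cong {n} (λ u → if-+ (blk u ≡ᵇ k) (f u) (g u)))
      where
      restrict : (Fin n → ℤ) → Fin n → ℤ
      restrict h u = if blk u ≡ᵇ k then h u else 0ℤ

    blockSum-cong : ∀ {f g} k → (∀ u → blk u ≡ k → f u ≡ g u) → blockSum f k ≡ blockSum g k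
    blockSum-cong {f} {g} k f≗g = sumℤ-cong {n} pointwise
      where
      pointwise : ∀ u → (if blk u ≡ᵇ k then f u else 0ℤ) ≡ (if blk u ≡ᵇ k then g u else 0ℤ)
      pointwise u with blk u ≡ᵇ k | ≡ᵇ-reflects (blk u) k
      ... | true  | ofʸ blk-u≡k = f≗g u blk-u≡k
      ... | false | _           = refl

    blockSum-const : ∀ y k → blockSum (λ _ → y) k ≡ + blockSize blk k * y
    blockSum-const y k = begin
      sumℤ (λ u → if blk u ≡ᵇ k then y else 0ℤ)  ≡⟨ sumℤ-cong {n} (λ u → if≡+b2n* (blk u ≡ᵇ k)) ⟩
      sumℤ (λ u → + b2n (blk u ≡ᵇ k) * y)       ≡⟨ *-distribʳ-sumℤ y (λ u → + b2n (blk u ≡ᵇ k)) ⟨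
      sumℤ (λ u → + b2n (blk u ≡ᵇ k)) * y       ≡⟨ cong (_* y) (+-sum (λ u → b2n (blk u ≡ᵇ k))) ⟨
      + blockSize blk k * y                     ∎
      where
      open ≡-Reasoning
      if≡+b2n* : ∀ b → (if b then y else 0ℤ) ≡ + b2n b * y
      if≡+b2n* true  = ≡-sym (ℤ.*-identityˡ y)
      if≡+b2n* false = refl

    closedSum+blockSum : ∀ f v → closedSum f v + blockSum f (blk v) ≡ sumℤ f + f v
    closedSum+blockSum f v = begin
      closedSum f v + blockSum f (blk v)         ≡⟨ sumℤ-distrib-+ closed inBlock ⟨
      sumℤ (λ u → closed u + inBlock u)          ≡⟨ sumℤ-cong {n} pointwise ⟩
      sumℤ (λ u → f u + at-v u)                  ≡⟨ sumℤ-distrib-+ f at-v ⟩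
      sumℤ f + sumℤ at-v                         ≡⟨ cong (_+_ (sumℤ f)) (sum-indicator ℤ.+-0-monoid f v) ⟩
      sumℤ f + f v                               ∎
      where
      open ≡-Reasoning
      closed inBlock at-v : Fin n → ℤ
      closed  u = if inN (complement (cliques blk)) v u then f u else 0ℤ
      inBlock u = if blk u ≡ᵇ blk v then f u else 0ℤ
      at-v    u = if toℕ u ≡ᵇ toℕ v then f u else 0ℤ
      pointwise : ∀ u → closed u + inBlock u ≡ f u + at-v u
      pointwise u rewrite ≡ᵇ-sym (toℕ v) (toℕ u) | ≡ᵇ-sym (blk v) (blk u)
        with toℕ u ≡ᵇ toℕ v | toℕ-≡ᵇ-reflects u v
      ... | true  | ofʸ refl rewrite ≡ᵇ-refl (blk u) = refl
      ... | false | _ with blk u ≡ᵇ blk v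
      ...   | true  = ℤ.+-comm 0ℤ (f u)
      ...   | false = refl

    -- On a clique K of size m not containing z, toggling X v = B - T - γ v (v ∈ K), where
    -- T = Σ X, leaves the label Σ_K γ + m T - (m - 1) B at every v ∈ K; this vanishes
    -- mod ℓ for B = ι (Σ_K γ + m T). At z the label is γ z + T, whence T = - γ z, and X z
    -- is adjusted so that the total is T.
    module Solution (ℓ : ℕ) .{{_ : NonZero ℓ}} {z : Fin n} (singleton : ∀ u → blk u ≡ blk z → u ≡ z)
                    (ι : ℕ → ℤ) (c : Fin n → Fin ℓ) where

      γ : Fin n → ℤ
      γ u = + toℕ (c u)

      T : ℤ
      T = - γ z

      m : ℕ → ℤ
      m k = + blockSize blk k

      B : ℕ → ℤ
      B k = ι (blockSize blk k) * (blockSum γ k + m k * T)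

      X₀ X : Fin n → ℤ
      X₀ u = B (blk u) - T - γ u
      X  u = X₀ u + (if toℕ u ≡ᵇ toℕ z then T - sumℤ X₀ else 0ℤ)

      x : Fin n → ℕ
      x u = X u %ℕ ℓ

      sum-X : sumℤ X ≡ T
      sum-X = begin
        sumℤ X                     ≡⟨ sumℤ-distrib-+ X₀ correction ⟩
        sumℤ X₀ + sumℤ correction
          ≡⟨ cong (_+_ (sumℤ X₀)) (sum-indicator ℤ.+-0-monoid (λ _ → T - sumℤ X₀) z) ⟩
        sumℤ X₀ + (T - sumℤ X₀)    ≡⟨ cancel (sumℤ X₀) T ⟩
        T                          ∎
        where
        open ≡-Reasoning
        correction : Fin n → ℤ
        correction u = if toℕ u ≡ᵇ toℕ z then T - sumℤ X₀ else 0ℤ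
        cancel : ∀ s t → s + (t - s) ≡ t
        cancel = solve-∀

      X≡X₀ : ∀ {u} → u ≢ z → X u ≡ X₀ u
      X≡X₀ {u} u≢z rewrite ≢⇒≡ᵇ-false (u≢z ∘ toℕ-injective) = ℤ.+-identityʳ (X₀ u)

      blockSum-X-at-z : blockSum X (blk z) ≡ X z
      blockSum-X-at-z =
        trans (sumℤ-cong {n} (λ u → cong (λ b → if b then X u else 0ℤ) (same-test u)))
              (sum-indicator ℤ.+-0-monoid X z)
        where
        same-test : ∀ u → (blk u ≡ᵇ blk z) ≡ (toℕ u ≡ᵇ toℕ z)
        same-test u with toℕ u ≡ᵇ toℕ z | toℕ-≡ᵇ-reflects u z
        ... | true  | ofʸ refl = ≡ᵇ-refl (blk u)
        ... | false | ofⁿ u≢z  = ≢⇒≡ᵇ-false (u≢z ∘ singleton u)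

      blockSum-X : ∀ {v} → v ≢ z →
        blockSum X (blk v) + blockSum γ (blk v) ≡ m (blk v) * (B (blk v) - T)
      blockSum-X {v} v≢z = begin
        blockSum X (blk v) + blockSum γ (blk v)          ≡⟨ blockSum-+ X γ (blk v) ⟩
        blockSum (λ u → X u + γ u) (blk v)               ≡⟨ blockSum-cong (blk v) on-block ⟩
        blockSum (λ _ → B (blk v) - T) (blk v)           ≡⟨ blockSum-const (B (blk v) - T) (blk v) ⟩
        m (blk v) * (B (blk v) - T)                      ∎
        where
        open ≡-Reasoning
        cancel : ∀ b t g → b - t - g + g ≡ b - t
        cancel = solve-∀
        on-block : ∀ u → blk u ≡ blk v → X u + γ u ≡ B (blk v) - T
        on-block u blk-u≡blk-v = begin
          X u + γ u
            ≡⟨ cong (_+ γ u) (X≡X₀ (v≢z ∘ singleton v ∘ trans (≡-sym blk-u≡blk-v) ∘ cong blk)) ⟩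
          B (blk u) - T - γ u + γ u ≡⟨ cancel (B (blk u)) T (γ u) ⟩
          B (blk u) - T             ≡⟨ cong (λ k → B k - T) blk-u≡blk-v ⟩
          B (blk v) - T             ∎

      X-wins-at-z : + ℓ ∣ γ z + closedSum X z
      X-wins-at-z = divides 0ℤ (begin
        γ z + closedSum X z                       ≡⟨ regroup (γ z) (closedSum X z) (X z) ⟩
        γ z + (closedSum X z + X z) - X z         ≡⟨ cong (λ s → γ z + s - X z) closedSum+X-z ⟩
        γ z + (T + X z) - X z                     ≡⟨ collapse (γ z) (X z) ⟩
        0ℤ                                        ∎)
        where
        open ≡-Reasoning
        regroup : ∀ g s w → g + s ≡ g + (s + w) - w
        regroup = solve-∀
        collapse : ∀ g w → g + (- g + w) - w ≡ 0ℤ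
        collapse = solve-∀
        closedSum+X-z : closedSum X z + X z ≡ T + X z
        closedSum+X-z = begin
          closedSum X z + X z                ≡⟨ cong (_+_ (closedSum X z)) blockSum-X-at-z ⟨
          closedSum X z + blockSum X (blk z) ≡⟨ closedSum+blockSum X z ⟩
          sumℤ X + X z                       ≡⟨ cong (_+ X z) sum-X ⟩
          T + X z                            ∎

      X-wins : ∀ {v} → v ≢ z → + ℓ ∣ (m (blk v) - 1ℤ) * ι (blockSize blk (blk v)) - 1ℤ →
        + ℓ ∣ γ v + closedSum X v
      X-wins {v} v≢z ℓ∣inverse = subst (+ ℓ ∣_) (≡-sym (begin
        γ v + closedSum X v                                ≡⟨ regroup (γ v) (closedSum X v) (blockSum X k) Γ ⟩
        γ v + (closedSum X v + blockSum X k) + Γ - (blockSum X k + Γ)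
          ≡⟨ cong₂ (λ s t → γ v + s + Γ - t) closedSum+blockSum-v (blockSum-X v≢z) ⟩
        γ v + (T + X₀ v) + Γ - m k * (B k - T)             ≡⟨ collapse (γ v) T Γ (m k) (ι (blockSize blk k)) ⟩
        (- (Γ + m k * T)) * ((m k - 1ℤ) * ι (blockSize blk k) - 1ℤ) ∎))
        (∣n⇒∣m*n (- (Γ + m k * T)) ℓ∣inverse)
        where
        open ≡-Reasoning
        k = blk v
        Γ = blockSum γ k
        regroup : ∀ g s y c → g + s ≡ g + (s + y) + c - (y + c)
        regroup = solve-∀
        collapse : ∀ g t c μ i → g + (t + (i * (c + μ * t) - t - g)) + c - μ * (i * (c + μ * t) - t)
                                   ≡ (- (c + μ * t)) * ((μ - 1ℤ) * i - 1ℤ)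
        collapse = solve-∀
        closedSum+blockSum-v : closedSum X v + blockSum X k ≡ T + X₀ v
        closedSum+blockSum-v = trans (closedSum+blockSum X v) (cong₂ _+_ sum-X (X≡X₀ v≢z))

      x-wins : (∀ v → v ≢ z → + ℓ ∣ (m (blk v) - 1ℤ) * ι (blockSize blk (blk v)) - 1ℤ) →
        ∀ v → + ℓ ∣ γ v + closedSum (+_ ∘ x) v
      x-wins inverse v = subst (+ ℓ ∣_) (regroup (γ v) (closedSum X v) (closedSum (+_ ∘ x) v))
        (∣m∣n⇒∣m+n X-wins-any (sumℤ-congruent _ _ residue))
        where
        regroup : ∀ g s t → g + s + (t - s) ≡ g + t
        regroup = solve-∀
        X-wins-any : + ℓ ∣ γ v + closedSum X v
        X-wins-any with v Fin.≟ z
        ... | yes refl = X-wins-at-z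
        ... | no v≢z   = X-wins v≢z (inverse v v≢z)
        residue : ∀ u → + ℓ ∣ (if inN (complement (cliques blk)) v u then + x u else 0ℤ)
                            - (if inN (complement (cliques blk)) v u then X u else 0ℤ)
        residue u with inN (complement (cliques blk)) v u
        ... | true  = ∣%ℕ-difference ℓ (X u)
        ... | false = divides 0ℤ refl

    complement-cliques-N-AW : ∀ ℓ .{{_ : NonZero ℓ}} {z} → (∀ u → blk u ≡ blk z → u ≡ z) →
      (ι : ℕ → ℤ) →
      (∀ v → v ≢ z → + ℓ ∣ (+ blockSize blk (blk v) - 1ℤ) * ι (blockSize blk (blk v)) - 1ℤ) →
      N-AW ℓ (complement (cliques blk))
    complement-cliques-N-AW ℓ singleton ι inverse c =
      x , Equivalence.from (Wins⇔ (complement (cliques blk)) c x) λ v →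
        ∣⇒∣ᵤ (subst (+ ℓ ∣_) (≡-sym (trans (ℤ.pos-+ (toℕ (c v)) _)
                                            (cong (_+_ (γ v)) (+-toggleSum (complement (cliques blk)) x v))))
                     (x-wins inverse v))
      where open Solution ℓ singleton ι c

    complement-cliques-N-AW-odd : ∀ r {z} → (∀ u → blk u ≡ blk z → u ≡ z) →
      (∀ v → v ≢ z → blockSize blk (blk v) ≡ 2 ⊎ blockSize blk (blk v) ≡ 3) →
      N-AW (suc (r ℕ.+ r)) (complement (cliques blk))
    complement-cliques-N-AW-odd r {z} singleton size-2-or-3 =
      complement-cliques-N-AW (suc (r ℕ.+ r)) singleton half inverse
      where
      half : ℕ → ℤ
      half 3 = + suc r
      half _ = 1ℤ
      two-halves : ∀ ρ → (+ 3 - 1ℤ) * (1ℤ + ρ) - 1ℤ ≡ 1ℤ * (1ℤ + (ρ + ρ))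
      two-halves = solve-∀
      inverse : ∀ v → v ≢ z →
        + suc (r ℕ.+ r) ∣ (+ blockSize blk (blk v) - 1ℤ) * half (blockSize blk (blk v)) - 1ℤ
      inverse v v≢z with size-2-or-3 v v≢z
      ... | inj₁ size≡2 rewrite size≡2 = divides 0ℤ refl
      ... | inj₂ size≡3 rewrite size≡3 = divides 1ℤ (two-halves (+ r))

open import Data.Nat using (_+_; _*_; _∸_; _≤_; _<_; _/_; _%_; ⌊_/2⌋; ⌈_/2⌉; z≤n; s≤s; s≤s⁻¹; z<s)
open import Data.Nat.Divisibility using (_∣_; divides)
open import Data.Nat.GCD using (gcd; gcd[m,n]∣m; gcd[m,n]∣n; gcd-zeroʳ)
open import Data.Nat.DivMod using (m*n/n≡m; m≡m%n+[m/n]*n; m%n<n)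
open import Data.Fin using (fromℕ)
open import Data.Fin.Properties using (toℕ-fromℕ; toℕ<n)

N-AW⇒edges≤ : ∀ {n ℓ d} k (G : Graph n) → 0 < n → n ≡ k + k → 1 < ℓ → d ∣ ℓ → d ∣ n ∸ 1 → d ≢ 1 →
  N-AW ℓ G → edges G ≤ n C 2 ∸ (k + 1)
N-AW⇒edges≤ {n} k G 0<n n≡2k 1<ℓ d∣ℓ d∣n-1 d≢1 aw = begin
  edges G                       ≡⟨ m+n∸n≡m (edges G) (edges H) ⟨
  edges G + edges H ∸ edges H   ≡⟨ cong (_∸ edges H) (edges+edges-complement G) ⟩
  n C 2 ∸ edges H               ≤⟨ ∸-monoʳ-≤ (n C 2) k+1≤e ⟩
  n C 2 ∸ (k + 1)               ∎
  where
  open ≤-Reasoning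
  H = complement G
  k+1≤e : k + 1 ≤ edges H
  k+1≤e = subst (_≤ edges H) (+-comm 1 k) (≰⇒> λ e≤k → <⇒≱
    (N-AW⇒dense-complement G 0<n (subst (2 ∣_) (≡-sym n≡2k) (2∣m+m k)) 1<ℓ d∣ℓ d∣n-1 d≢1 aw)
    (subst (edges H + edges H ≤_) (≡-sym n≡2k) (+-mono-≤ e≤k e≤k)))

count-value : ∀ {M} a → a < M → ∑[ u < M ] b2n (toℕ u ≡ᵇ a) ≡ 1
count-value {M} a a<M =
  subst (λ t → ∑[ u < M ] b2n (toℕ u ≡ᵇ t) ≡ 1) (toℕ-fromℕ< a<M) (count-indicator (fromℕ< a<M))

b2n-⌊/2⌋≡ᵇ : ∀ j q → b2n (⌊ j /2⌋ ≡ᵇ q) ≡ b2n (j ≡ᵇ q + q) + b2n (j ≡ᵇ suc (q + q))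
b2n-⌊/2⌋≡ᵇ zero          zero    = refl
b2n-⌊/2⌋≡ᵇ zero          (suc q) = refl
b2n-⌊/2⌋≡ᵇ (suc zero)    zero    = refl
b2n-⌊/2⌋≡ᵇ (suc zero)    (suc q) rewrite +-suc q q = refl
b2n-⌊/2⌋≡ᵇ (suc (suc j)) zero    = refl
b2n-⌊/2⌋≡ᵇ (suc (suc j)) (suc q) rewrite +-suc q q = b2n-⌊/2⌋≡ᵇ j q

count-⌊/2⌋ : ∀ {M} q → suc (q + q) < M → ∑[ u < M ] b2n (⌊ toℕ u /2⌋ ≡ᵇ q) ≡ 2
count-⌊/2⌋ {M} q 2q+1<M = begin
  ∑[ u < M ] b2n (⌊ toℕ u /2⌋ ≡ᵇ q)         ≡⟨ sum-cong-≗ {M} (λ u → b2n-⌊/2⌋≡ᵇ (toℕ u) q) ⟩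
  ∑[ u < M ] (even u + odd u)              ≡⟨ ∑-distrib-+ even odd ⟩
  ∑[ u < M ] even u + ∑[ u < M ] odd u
    ≡⟨ cong₂ _+_ (count-value (q + q) (<-trans (n<1+n _) 2q+1<M)) (count-value (suc (q + q)) 2q+1<M) ⟩
  2                                        ∎
  where
  open ≡-Reasoning
  even odd : Fin M → ℕ
  even u = b2n (toℕ u ≡ᵇ q + q)
  odd  u = b2n (toℕ u ≡ᵇ suc (q + q))

⌊/2⌋-< : ∀ {j p} → j < p + p → ⌊ j /2⌋ < p
⌊/2⌋-< {j} {p} j<2p = ≰⇒> λ p≤⌊j/2⌋ → <⇒≱ j<2p (begin
  p + p                 ≤⟨ +-mono-≤ p≤⌊j/2⌋ (≤-trans p≤⌊j/2⌋ (⌊n/2⌋≤⌈n/2⌉ j)) ⟩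
  ⌊ j /2⌋ + ⌈ j /2⌉     ≡⟨ ⌊n/2⌋+⌈n/2⌉≡n j ⟩
  j                     ∎)
  where open ≤-Reasoning

-- Vertex 3 + j (j ≤ p + p) has label  if j ≡ᵇ p + p then N else suc ⌊ j /2⌋ ; the lemmas
-- below are stated for that expression so that they apply to it by case analysis on j.
module C3∪P2s∪K1-structure (p : ℕ) where

  N : ℕ
  N = 4 + (p + p)

  blk : Fin N → ℕ
  blk = C3∪P2s∪K1-block N

  last : Fin N
  last = Fin.suc (Fin.suc (Fin.suc (fromℕ (p + p))))

  blk-last : blk last ≡ N
  blk-last rewrite toℕ-fromℕ (p + p) | ≡ᵇ-refl (p + p) = refl

  pair-index : ∀ (j : Fin (suc (p + p))) → toℕ j ≢ p + p → toℕ j < p + p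
  pair-index j j≢2p = ≤∧≢⇒< (s≤s⁻¹ (toℕ<n j)) j≢2p

  size-triangle : blockSize blk 0 ≡ 3
  size-triangle =
    cong (3 +_) (trans (sum-cong-≗ {suc (p + p)} not-0) (sum-replicate-zero (suc (p + p))))
    where
    not-0 : ∀ j → b2n ((if toℕ j ≡ᵇ p + p then N else suc ⌊ toℕ j /2⌋) ≡ᵇ 0) ≡ 0
    not-0 j with toℕ j ≡ᵇ p + p
    ... | true  = refl
    ... | false = refl

  pair-label<N : ∀ (j : Fin (suc (p + p))) → toℕ j ≢ p + p → suc ⌊ toℕ j /2⌋ < N
  pair-label<N j j≢2p =
    s≤s (≤-trans (s≤s (⌊n/2⌋≤n (toℕ j))) (≤-trans (pair-index j j≢2p) (m≤n+m (p + p) 3)))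

  size-last : blockSize blk N ≡ 1
  size-last = trans (sum-cong-≗ {suc (p + p)} at-end) (count-value (p + p) ≤-refl)
    where
    at-end : ∀ j → b2n ((if toℕ j ≡ᵇ p + p then N else suc ⌊ toℕ j /2⌋) ≡ᵇ N) ≡ b2n (toℕ j ≡ᵇ p + p)
    at-end j with toℕ j ≡ᵇ p + p | ≡ᵇ-reflects (toℕ j) (p + p)
    ... | true  | _        = cong b2n (≡ᵇ-refl N)
    ... | false | ofⁿ j≢2p = cong b2n (≢⇒≡ᵇ-false (<⇒≢ (pair-label<N j j≢2p)))

  size-pair : ∀ {q} → q < p → blockSize blk (suc q) ≡ 2
  size-pair {q} q<p = trans (sum-cong-≗ {suc (p + p)} same-half) (count-⌊/2⌋ q 2q+1<2p+1)
    where
    2q+1<2p+1 : suc (q + q) < suc (p + p)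
    2q+1<2p+1 = s≤s (+-mono-≤ q<p (<⇒≤ q<p))
    same-half : ∀ j → b2n ((if toℕ j ≡ᵇ p + p then N else suc ⌊ toℕ j /2⌋) ≡ᵇ suc q)
                    ≡ b2n (⌊ toℕ j /2⌋ ≡ᵇ q)
    same-half j with toℕ j ≡ᵇ p + p | ≡ᵇ-reflects (toℕ j) (p + p)
    ... | false | _        = refl
    ... | true  | ofʸ j≡2p = trans (cong b2n (≢⇒≡ᵇ-false (<⇒≢ q+1<N ∘ ≡-sym)))
                                   (≡-sym (cong b2n (≢⇒≡ᵇ-false λ ⌊j/2⌋≡q →
                                      <⇒≢ q<p (trans (≡-sym ⌊j/2⌋≡q) ⌊j/2⌋≡p))))
      where
      q+1<N : suc q < N
      q+1<N = s≤s (≤-trans q<p (≤-trans (m≤m+n p p) (m≤n+m (p + p) 3)))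
      ⌊j/2⌋≡p : ⌊ toℕ j /2⌋ ≡ p
      ⌊j/2⌋≡p = trans (cong ⌊_/2⌋ j≡2p) (≡-sym (n≡⌊n+n/2⌋ p))

  size-pair-vertex : ∀ j → toℕ j ≢ p + p →
    blockSize blk (if toℕ j ≡ᵇ p + p then N else suc ⌊ toℕ j /2⌋) ≡ 2
  size-pair-vertex j j≢2p rewrite ≢⇒≡ᵇ-false j≢2p = size-pair (⌊/2⌋-< (pair-index j j≢2p))

  is-last : ∀ j → toℕ j ≡ p + p → Fin.suc (Fin.suc (Fin.suc j)) ≡ last
  is-last j j≡2p =
    cong (Fin.suc ∘ Fin.suc ∘ Fin.suc) (toℕ-injective (trans j≡2p (≡-sym (toℕ-fromℕ (p + p)))))

  singleton : ∀ u → blk u ≡ blk last → u ≡ last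
  singleton Fin.zero                         e = case trans e blk-last of λ ()
  singleton (Fin.suc Fin.zero)               e = case trans e blk-last of λ ()
  singleton (Fin.suc (Fin.suc Fin.zero))     e = case trans e blk-last of λ ()
  singleton (Fin.suc (Fin.suc (Fin.suc j))) e with toℕ j ≡ᵇ p + p | ≡ᵇ-reflects (toℕ j) (p + p)
  ... | true  | ofʸ j≡2p = is-last j j≡2p
  ... | false | ofⁿ j≢2p = ⊥-elim (<⇒≢ (pair-label<N j j≢2p) (trans e blk-last))

  size-2-or-3 : ∀ v → v ≢ last → blockSize blk (blk v) ≡ 2 ⊎ blockSize blk (blk v) ≡ 3
  size-2-or-3 Fin.zero                         _ = inj₂ size-triangle
  size-2-or-3 (Fin.suc Fin.zero)               _ = inj₂ size-triangle
  size-2-or-3 (Fin.suc (Fin.suc Fin.zero))     _ = inj₂ size-triangle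
  size-2-or-3 (Fin.suc (Fin.suc (Fin.suc j))) v≢last =
    inj₁ (size-pair-vertex j (v≢last ∘ is-last j))

  degree≡size∸1 : ∀ v → degree (cliques blk) v ≡ blockSize blk (blk v) ∸ 1
  degree≡size∸1 v = trans (≡-sym (m+n∸n≡m _ 1)) (cong (_∸ 1) (degree-cliques blk v))

  degree-pair-vertex : ∀ j →
    degree (cliques blk) (Fin.suc (Fin.suc (Fin.suc j))) ≡ b2n (not (toℕ j ≡ᵇ p + p))
  degree-pair-vertex j = trans (degree≡size∸1 (Fin.suc (Fin.suc (Fin.suc j)))) by-size
    where
    by-size : blockSize blk (if toℕ j ≡ᵇ p + p then N else suc ⌊ toℕ j /2⌋) ∸ 1
            ≡ b2n (not (toℕ j ≡ᵇ p + p))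
    by-size with toℕ j ≡ᵇ p + p | ≡ᵇ-reflects (toℕ j) (p + p)
    ... | true  | _        = cong (_∸ 1) size-last
    ... | false | ofⁿ j≢2p = cong (_∸ 1) (size-pair (⌊/2⌋-< (pair-index j j≢2p)))

  degree-sum : ∑[ v < N ] degree (cliques blk) v ≡ 6 + (p + p)
  degree-sum = cong₂ (λ a b → a + (a + (a + b)))
    (trans (degree≡size∸1 Fin.zero) (cong (_∸ 1) size-triangle))
    (trans (sum-cong-≗ {suc (p + p)} degree-pair-vertex) others)
    where
    others : ∑[ j < suc (p + p) ] b2n (not (toℕ j ≡ᵇ p + p)) ≡ p + p
    others = suc-injective (trans (+-comm 1 _)
      (subst (λ t → ∑[ j < suc (p + p) ] b2n (not (toℕ j ≡ᵇ t)) + 1 ≡ suc (p + p))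
             (toℕ-fromℕ (p + p)) (count-others (fromℕ (p + p)))))

  edges-C3∪P2s∪K1 : edges (C3∪P2s∪K1 N) ≡ 3 + p
  edges-C3∪P2s∪K1 = begin
    edges (C3∪P2s∪K1 N)
      ≡⟨ n≡⌊n+n/2⌋ _ ⟩
    ⌊ edges (C3∪P2s∪K1 N) + edges (C3∪P2s∪K1 N) /2⌋
      ≡⟨ cong ⌊_/2⌋ (trans (≡-sym (handshake (C3∪P2s∪K1 N))) degree-sum) ⟩
    3 + ⌊ p + p /2⌋
      ≡⟨ cong (3 +_) (n≡⌊n+n/2⌋ p) ⟨
    3 + p ∎
    where open ≡-Reasoning

m*2≡m+m : ∀ m → m * 2 ≡ m + m
m*2≡m+m m = trans (*-comm m 2) (cong (m +_) (+-identityʳ m))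

even≥4⇒≡4+p+p : ∀ {n} → 4 ≤ n → 2 ∣ n → ∃ λ p → n ≡ 4 + (p + p)
even≥4⇒≡4+p+p ()                    (divides zero refl)
even≥4⇒≡4+p+p (s≤s (s≤s ()))        (divides (suc zero) refl)
even≥4⇒≡4+p+p _                     (divides (suc (suc p)) refl) = p , cong (4 +_) (m*2≡m+m p)

odd⇒≡1+r+r : ∀ {ℓ} → ¬ 2 ∣ ℓ → ∃ λ r → ℓ ≡ suc (r + r)
odd⇒≡1+r+r {ℓ} ¬2∣ℓ with ℓ % 2 | m≡m%n+[m/n]*n ℓ 2 | m%n<n ℓ 2
... | 0           | ℓ≡[ℓ/2]*2 | _              = ⊥-elim (¬2∣ℓ (divides (ℓ / 2) ℓ≡[ℓ/2]*2))
... | 1           | ℓ≡1+[ℓ/2]*2 | _            =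
  ℓ / 2 , trans ℓ≡1+[ℓ/2]*2 (cong suc (m*2≡m+m (ℓ / 2)))
... | suc (suc _) | _         | s≤s (s≤s ())

gcd≢1⇒1<1+r+r : ∀ m r → gcd m (suc (r + r)) ≢ 1 → 1 < suc (r + r)
gcd≢1⇒1<1+r+r m zero    gcd≢1 = ⊥-elim (gcd≢1 (gcd-zeroʳ m))
gcd≢1⇒1<1+r+r m (suc r) _     = s≤s (s≤s z≤n)

proposition4p4 : (n ℓ : ℕ) → 4 ≤ n → 2 ∣ n → ¬ (2 ∣ ℓ) → gcd (n ∸ 1) ℓ ≢ 1 →
    (∀ (G : Graph n) → N-AW ℓ G → edges G ≤ n C 2 ∸ (n / 2 + 1))
    × (N-AW ℓ (complement (C3∪P2s∪K1 n)) × edges (complement (C3∪P2s∪K1 n)) ≡ n C 2 ∸ (n / 2 + 1))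
proposition4p4 n ℓ 4≤n 2∣n ¬2∣ℓ gcd≢1
  with p , refl ← even≥4⇒≡4+p+p 4≤n 2∣n | r , refl ← odd⇒≡1+r+r ¬2∣ℓ =
  upper-bound , complement-cliques-N-AW-odd blk r singleton size-2-or-3 , extremal-edges
  where
  open C3∪P2s∪K1-structure p
  k = 2 + p
  N≡k+k : N ≡ k + k
  N≡k+k = cong (2 +_) (≡-sym (trans (+-suc p (suc p)) (cong suc (+-suc p p))))
  N/2+1≡k+1 : N / 2 + 1 ≡ k + 1
  N/2+1≡k+1 = cong (_+ 1) (trans (cong (λ t → (4 + t) / 2) (≡-sym (m*2≡m+m p))) (m*n/n≡m k 2))

  upper-bound : ∀ G → N-AW (suc (r + r)) G → edges G ≤ N C 2 ∸ (N / 2 + 1)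
  upper-bound G aw = subst (λ t → edges G ≤ N C 2 ∸ t) (≡-sym N/2+1≡k+1)
    (N-AW⇒edges≤ k G z<s N≡k+k (gcd≢1⇒1<1+r+r (N ∸ 1) r gcd≢1)
      (gcd[m,n]∣n (N ∸ 1) (suc (r + r))) (gcd[m,n]∣m (N ∸ 1) (suc (r + r))) gcd≢1 aw)

  extremal-edges : edges (complement (C3∪P2s∪K1 N)) ≡ N C 2 ∸ (N / 2 + 1)
  extremal-edges = begin
    edges (complement H)                        ≡⟨ m+n∸m≡n (edges H) _ ⟨
    edges H + edges (complement H) ∸ edges H    ≡⟨ cong₂ _∸_ (edges+edges-complement H) edges-H ⟩
    N C 2 ∸ (N / 2 + 1)                         ∎
    where
    open ≡-Reasoning
    H = C3∪P2s∪K1 N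
    edges-H : edges H ≡ N / 2 + 1
    edges-H = trans edges-C3∪P2s∪K1 (≡-sym (trans N/2+1≡k+1 (+-comm k 1)))
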